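{- Let $\mathcal{L}_\wedge$ be a sublanguage of $\mathcal{L}=\{\wedge,\vee,\to,\neg,0,1\}$ containing $\wedge$, and let $\Phi$ be a Sahlqvist quasiequation in $\mathcal{L}_\wedge$. If an $\mathcal{L}_\wedge$-subreduct $\boldsymbol{A}$ of a Heyting algebra validates $\Phi$, then the Heyting algebra $\mathsf{Up}(\boldsymbol{A}_\ast)$ validates $\Phi$.
   Context: $\mathcal{L}=\{\wedge,\vee,\to,\neg,0,1\}$ is the language of intuitionistic propositional logic; formulas are built from a denumerable set of variables. An occurrence of a variable in a formula is positive (resp. negative) if the total number of negations and antecedents of implications within whose scope it lies is even (resp. odd); a formula is positive (resp. negative) if every occurrence of every variable in it is positive (resp. negative). A Sahlqvist antecedent is a formula built from variables, negative formulas and the constants $0,1$ using only $\wedge$ and $\vee$. A Sahlqvist implication is a formula that is positive, or of the form $\neg\varphi$ with $\varphi$ a Sahlqvist antecedent, or of the form $\varphi\to\psi$ with $\varphi$ a Sahlqvist antecedent and $\psi$ positive. A Sahlqvist quasiequation is an expression $\Phi=(\varphi_1\wedge y\le z\ \&\cdots\&\ \varphi_n\wedge y\le z\Longrightarrow y\le z)$ where $y,z$ are distinct variables not occurring in $\varphi_1,\dots,\varphi_n$, each $\varphi_i$ is obtained from Sahlqvist implications using only $\wedge$ and $\vee$, and $a\le b$ abbreviates the equation $a\wedge b\approx a$; it is read as a universally quantified quasiequation and an algebra validates it if it satisfies it. $\Phi$ is in a sublanguage $\mathcal{L}'$ if all $\varphi_i$ are $\mathcal{L}'$-formulas. An $\mathcal{L}'$-subreduct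 of a Heyting algebra is a subalgebra of the reduct of a Heyting algebra to the operations of $\mathcal{L}'$. For a semilattice $\langle A;\wedge\rangle$, a filter is a nonempty upset closed under $\wedge$; a filter is meet irreducible if it is proper and is not the intersection of two filters both different from it; $\boldsymbol{A}_\ast$ denotes the poset of meet irreducible filters of $\langle A;\wedge\rangle$ ordered by inclusion. For a poset $\mathbb{X}$, $\mathsf{Up}(\mathbb{X})$ is the Heyting algebra $\langle \mathrm{Up}(\mathbb{X});\cap,\cup,\to,\emptyset,X\rangle$ of upsets of $\mathbb{X}$, with $U\to V=X\setminus{\downarrow}(U\setminus V)$ and $\neg U=U\to\emptyset$. -}

module Defs where

open import Level using (Level; _⊔_; Lift) renaming (suc to lsuc)
open import Data.Nat using (ℕ)
open import Data.Bool using (Bool; true; false)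
open import Data.Empty renaming (⊥ to Empty)
open import Data.Unit renaming (⊤ to Unit)
open import Data.Product using (Σ; ∃; _×_; _,_; proj₁; proj₂)
open import Data.Sum using (_⊎_)
open import Data.List using (List)
open import Data.List.Relation.Unary.All using (All)
open import Relation.Nullary using (¬_)
open import Relation.Unary using (Pred)
open import Relation.Binary using (Rel; Reflexive; Transitive)
open import Relation.Binary.PropositionalEquality using (_≡_; _≢_)
open import Relation.Binary.Lattice.Bundles using (HeytingAlgebra)
open import Axiom.ExcludedMiddle public using (ExcludedMiddle)

infixr 7 _∧ᶠ_
infixr 6 _∨ᶠ_
infixr 5 _⇒ᶠ_

data Fm : Set where
  var   : ℕ → Fm
  _∧ᶠ_  : Fm → Fm → Fm
  _∨ᶠ_  : Fm → Fm → Fm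
  _⇒ᶠ_  : Fm → Fm → Fm
  ¬ᶠ_   : Fm → Fm
  𝟘     : Fm
  𝟙     : Fm

Occurs : ℕ → Fm → Set
Occurs x (var y)  = x ≡ y
Occurs x (a ∧ᶠ b) = Occurs x a ⊎ Occurs x b
Occurs x (a ∨ᶠ b) = Occurs x a ⊎ Occurs x b
Occurs x (a ⇒ᶠ b) = Occurs x a ⊎ Occurs x b
Occurs x (¬ᶠ a)   = Occurs x a
Occurs x 𝟘        = Empty
Occurs x 𝟙        = Empty

-- Positive / negative formulas: every variable occurrence lies in the
-- scope of an even / odd number of negations and antecedents of implications.
Positive Negative : Fm → Set
Positive (var x)  = Unit
Positive (a ∧ᶠ b) = Positive a × Positive b
Positive (a ∨ᶠ b) = Positive a × Positive b
Positive (a ⇒ᶠ b) = Negative a × Positive b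
Positive (¬ᶠ a)   = Negative a
Positive 𝟘        = Unit
Positive 𝟙        = Unit
Negative (var x)  = Empty
Negative (a ∧ᶠ b) = Negative a × Negative b
Negative (a ∨ᶠ b) = Negative a × Negative b
Negative (a ⇒ᶠ b) = Positive a × Negative b
Negative (¬ᶠ a)   = Positive a
Negative 𝟘        = Unit
Negative 𝟙        = Unit

data SahlAnt : Fm → Set where
  ant-var : ∀ x → SahlAnt (var x)
  ant-neg : ∀ {φ} → Negative φ → SahlAnt φ
  ant-𝟘   : SahlAnt 𝟘
  ant-𝟙   : SahlAnt 𝟙
  ant-∧   : ∀ {φ ψ} → SahlAnt φ → SahlAnt ψ → SahlAnt (φ ∧ᶠ ψ)
  ant-∨   : ∀ {φ ψ} → SahlAnt φ → SahlAnt ψ → SahlAnt (φ ∨ᶠ ψ)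

data SahlImp : Fm → Set where
  imp-pos : ∀ {φ} → Positive φ → SahlImp φ
  imp-¬   : ∀ {φ} → SahlAnt φ → SahlImp (¬ᶠ φ)
  imp-⇒   : ∀ {φ ψ} → SahlAnt φ → Positive ψ → SahlImp (φ ⇒ᶠ ψ)

data SahlBody : Fm → Set where
  body-imp : ∀ {φ} → SahlImp φ → SahlBody φ
  body-∧   : ∀ {φ ψ} → SahlBody φ → SahlBody ψ → SahlBody (φ ∧ᶠ ψ)
  body-∨   : ∀ {φ ψ} → SahlBody φ → SahlBody ψ → SahlBody (φ ∨ᶠ ψ)

-- A Sahlqvist quasiequation
--   φ₁ ∧ y ≤ z & ... & φₙ ∧ y ≤ z ⟹ y ≤ z
record SahlQE : Set where
  field
    premises   : List Fm
    y z        : ℕ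
    y≢z        : y ≢ z
    sahlqvist  : All SahlBody premises
    y-fresh    : All (λ φ → ¬ Occurs y φ) premises
    z-fresh    : All (λ φ → ¬ Occurs z φ) premises

record Lang : Set where
  field
    has∨ has⇒ has¬ has𝟘 has𝟙 : Bool

module _ (L : Lang) where
  open Lang L

  InLang : Fm → Set
  InLang (var x)  = Unit
  InLang (a ∧ᶠ b) = InLang a × InLang b
  InLang (a ∨ᶠ b) = has∨ ≡ true × InLang a × InLang b
  InLang (a ⇒ᶠ b) = has⇒ ≡ true × InLang a × InLang b
  InLang (¬ᶠ a)   = has¬ ≡ true × InLang a
  InLang 𝟘        = has𝟘 ≡ true
  InLang 𝟙        = has𝟙 ≡ true

  QEInLang : SahlQE → Set
  QEInLang Φ = All InLang (SahlQE.premises Φ)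

module _ {c ℓ₁ ℓ₂} (H : HeytingAlgebra c ℓ₁ ℓ₂) where
  open HeytingAlgebra H

  evalH : Fm → (ℕ → Carrier) → Carrier
  evalH (var x)  g = g x
  evalH (a ∧ᶠ b) g = evalH a g ∧ evalH b g
  evalH (a ∨ᶠ b) g = evalH a g ∨ evalH b g
  evalH (a ⇒ᶠ b) g = evalH a g ⇨ evalH b g
  evalH (¬ᶠ a)   g = evalH a g ⇨ ⊥
  evalH 𝟘        g = ⊥
  evalH 𝟙        g = ⊤

  -- A subset of H closed under the operations of L, i.e. (the universe of)
  -- a subalgebra of the L-reduct of H: an L-subreduct of H.
  record IsSubreduct (L : Lang) {p} (P : Pred Carrier p) : Set (c ⊔ p) where
    open Lang L
    field
      ∧-closed : ∀ {a b} → P a → P b → P (a ∧ b)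
      ∨-closed : has∨ ≡ true → ∀ {a b} → P a → P b → P (a ∨ b)
      ⇒-closed : has⇒ ≡ true → ∀ {a b} → P a → P b → P (a ⇨ b)
      ¬-closed : has¬ ≡ true → ∀ {a} → P a → P (a ⇨ ⊥)
      𝟘-closed : has𝟘 ≡ true → P ⊥
      𝟙-closed : has𝟙 ≡ true → P ⊤

  module _ {L : Lang} {p} {P : Pred Carrier p} (sub : IsSubreduct L P) where
    El : Set (c ⊔ p)
    El = Σ Carrier P

    _∧A_ : El → El → El
    a ∧A b = (proj₁ a ∧ proj₁ b) , IsSubreduct.∧-closed sub (proj₂ a) (proj₂ b)

    _≤A_ : El → El → Set ℓ₁
    a ≤A b = proj₁ (a ∧A b) ≈ proj₁ a

    -- A validates Φ: for every assignment of variables to elements of A.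
    -- (The value of an L-formula under such an assignment is computed with
    -- the operations of H, which restrict to those of A.)
    ValidSub : SahlQE → Set (c ⊔ p ⊔ ℓ₁)
    ValidSub Φ = (g : ℕ → El) →
      All (λ φ → let v = evalH (φ ∧ᶠ var y) (λ i → proj₁ (g i)) in
                 (v ∧ proj₁ (g z)) ≈ v) premises →
      g y ≤A g z
      where open SahlQE Φ

    ℓF : Level
    ℓF = c ⊔ p ⊔ ℓ₁

    SubA : Set (lsuc ℓF)
    SubA = Pred El ℓF

    _≐_ : SubA → SubA → Set ℓF
    F ≐ G = ∀ a → (F a → G a) × (G a → F a)

    _∩_ : SubA → SubA → SubA
    (F ∩ G) a = F a × G a

    record IsFilter (F : SubA) : Set ℓF where
      field
        nonempty : ∃ λ a → F a
        upset    : ∀ {a b} → F a → a ≤A b → F b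
        meet     : ∀ {a b} → F a → F b → F (a ∧A b)

    record IsMeetIrreducible (F : SubA) : Set (lsuc ℓF) where
      field
        proper      : ∃ λ a → ¬ F a
        irreducible : ¬ (Σ SubA λ G → Σ SubA λ K →
                          IsFilter G × IsFilter K × (F ≐ (G ∩ K)) ×
                          ¬ (G ≐ F) × ¬ (K ≐ F))

    -- the poset A_* of meet irreducible filters, ordered by inclusion
    Pt : Set (lsuc ℓF)
    Pt = Σ SubA λ F → IsFilter F × IsMeetIrreducible F

    _⊑_ : Pt → Pt → Set ℓF
    x ⊑ x' = ∀ a → proj₁ x a → proj₁ x' a

    SubX : Set (lsuc (lsuc ℓF))
    SubX = Pred Pt (lsuc ℓF)

    IsUpset : SubX → Set (lsuc ℓF)
    IsUpset U = ∀ {x x'} → x ⊑ x' → U x → U x'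

    UpSet : Set (lsuc (lsuc ℓF))
    UpSet = Σ SubX IsUpset

    ∅ᵘ : SubX
    ∅ᵘ _ = Lift _ Empty

    Xᵘ : SubX
    Xᵘ _ = Lift _ Unit

    _∩ᵘ_ _∪ᵘ_ _→ᵘ_ : SubX → SubX → SubX
    (U ∩ᵘ V) x = U x × V x
    (U ∪ᵘ V) x = U x ⊎ V x
    (U →ᵘ V) x = ¬ (Σ Pt λ x' → x ⊑ x' × U x' × ¬ V x')

    ¬ᵘ_ : SubX → SubX
    ¬ᵘ U = U →ᵘ ∅ᵘ

    evalU : Fm → (ℕ → UpSet) → SubX
    evalU (var x)  V = proj₁ (V x)
    evalU (a ∧ᶠ b) V = evalU a V ∩ᵘ evalU b V
    evalU (a ∨ᶠ b) V = evalU a V ∪ᵘ evalU b V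
    evalU (a ⇒ᶠ b) V = evalU a V →ᵘ evalU b V
    evalU (¬ᶠ a)   V = ¬ᵘ evalU a V
    evalU 𝟘        V = ∅ᵘ
    evalU 𝟙        V = Xᵘ

    _≐ᵘ_ : SubX → SubX → Set (lsuc ℓF)
    U ≐ᵘ W = ∀ x → (U x → W x) × (W x → U x)

    ValidUp : SahlQE → Set (lsuc (lsuc ℓF))
    ValidUp Φ = (V : ℕ → UpSet) →
      All (λ φ → let v = evalU (φ ∧ᶠ var y) V in
                 (v ∩ᵘ proj₁ (V z)) ≐ᵘ v) premises →
      (proj₁ (V y) ∩ᵘ proj₁ (V z)) ≐ᵘ proj₁ (V y)
      where open SahlQE Φ

-- Classical metatheory (the paper works in ZFC): Zorn's lemma for
-- preordered types.

Zorn : (a r k : Level) → Set (lsuc (a ⊔ r ⊔ k))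
Zorn a r k = (X : Set a) (_≤_ : Rel X r) → Reflexive _≤_ → Transitive _≤_ →
  ((C : Pred X k) → (∀ {x y} → C x → C y → (x ≤ y) ⊎ (y ≤ x)) →
     ∃ λ u → ∀ {x} → C x → x ≤ u) →
  ∃ λ m → ∀ y → m ≤ y → y ≤ m

-- Suppose Up(A_*) refutes Φ: a point x₀ lies in V y but not in V z, so every premise φᵢ fails
-- at x₀. As in Sahlqvist's method, each failure depends on finitely many points of V only:
-- under the least valuation V₀ containing them positive formulas stay false and negative ones
-- stay true, and over V₀ both facts are witnessed by all assignments into A below a fixed one.
-- Positive formulas need that meet irreducible filters are prime for the joins existing in A and
-- that a point can be separated from finitely many points not below it (by ⇨, or by ¬ at a
-- maximal point); negative formulas need that a filter avoiding a directed set extends to a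
-- maximal such filter, which is meet irreducible (Zorn). The resulting values φᵢ(g) ∉ x₀ have a
-- common bound: some c ∉ x₀ and f ∈ x₀ with φᵢ(g) ∧ f ≤ c for all i. Sending y to f and z to c
-- makes every premise true in A, so f ≤ c and c ∈ x₀, a contradiction.

module Submission where

open import Level using (Level; _⊔_; Lift; lift; lower) renaming (suc to lsuc)
open import Data.Nat using (ℕ; _≟_)
open import Data.Bool using (true)
open import Data.Empty using (⊥-elim)
open import Data.Unit using (tt)
open import Data.Product using (Σ; ∃; _×_; _,_; proj₁; proj₂)
open import Data.Sum using (_⊎_; inj₁; inj₂)
open import Data.List using (List; []; _∷_; _++_)
open import Data.List.Relation.Unary.All as All using (All; []; _∷_)
open import Data.List.Relation.Unary.All.Properties using (++⁺; ++⁻ˡ; ++⁻ʳ; ¬Any⇒All¬)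
open import Data.List.Relation.Unary.Any as Any using (Any)
open import Relation.Nullary using (¬_; yes; no)
open import Relation.Nullary.Decidable using (True; toWitness; fromWitness)
open import Function using (_∘_)
open import Relation.Unary using (Pred; _⊆_; _≬_)
open import Relation.Binary.PropositionalEquality
  using (_≡_; refl; _≢_; sym; trans; cong; cong₂; subst; subst₂)
open import Relation.Binary using (Rel)
open import Relation.Binary.Lattice.Bundles using (HeytingAlgebra)
open import Axiom.DoubleNegationElimination using (em⇒dne)
import Relation.Binary.Lattice.Properties.MeetSemilattice as MeetProperties
import Relation.Binary.Lattice.Properties.JoinSemilattice as JoinProperties
import Relation.Binary.Lattice.Properties.HeytingAlgebra as HeytingProperties
open import Defs

module _ (lem : ∀ {ℓ} → ExcludedMiddle ℓ) where

  ¬×⇒¬⊎¬ : ∀ {a b} {X : Set a} {Y : Set b} → ¬ (X × Y) → ¬ X ⊎ ¬ Y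
  ¬×⇒¬⊎¬ {X = X} ¬xy with lem {P = X}
  ... | yes x = inj₂ λ y → ¬xy (x , y)
  ... | no ¬x = inj₁ ¬x

  ¬⊆⇒∃∉ : ∀ {a r s} {X : Set a} {R : Pred X r} {S : Pred X s} →
          ¬ (∀ x → R x → S x) → ∃ λ x → R x × ¬ S x
  ¬⊆⇒∃∉ ¬R⊆S = em⇒dne lem λ ¬∃ → ¬R⊆S λ x Rx → em⇒dne lem λ ¬Sx → ¬∃ (x , Rx , ¬Sx)

  -- Excluded middle makes every proposition equivalent to one in Set₀.
  Resize : ∀ {k} ℓ → Set k → Set ℓ
  Resize ℓ X = Lift ℓ (True (lem {P = X}))

  resize : ∀ {k ℓ} {X : Set k} → X → Resize ℓ X
  resize x = lift (fromWitness x)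

  unresize : ∀ {k ℓ} {X : Set k} → Resize ℓ X → X
  unresize r = toWitness (lower r)

infixl 9 _[_↦_]

_[_↦_] : ∀ {a} {X : Set a} → (ℕ → X) → ℕ → X → ℕ → X
(g [ i ↦ x ]) j with j ≟ i
... | yes _ = x
... | no  _ = g j

[↦]-≡ : ∀ {a} {X : Set a} (g : ℕ → X) i x → (g [ i ↦ x ]) i ≡ x
[↦]-≡ g i x with i ≟ i
... | yes _   = refl
... | no  i≢i = ⊥-elim (i≢i refl)

[↦]-≢ : ∀ {a} {X : Set a} (g : ℕ → X) {i j} x → j ≢ i → (g [ i ↦ x ]) j ≡ g j
[↦]-≢ g {i} {j} x j≢i with j ≟ i
... | yes j≡i = ⊥-elim (j≢i j≡i)
... | no  _   = refl

module Transfer (lem : ∀ {ℓ} → ExcludedMiddle ℓ) (zorn : ∀ {a r k} → Zorn a r k)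
  {c ℓ₁ ℓ₂ p} {L : Lang} (H : HeytingAlgebra c ℓ₁ ℓ₂)
  {P : Pred (HeytingAlgebra.Carrier H) p} (sub : IsSubreduct H L P) where

  open HeytingAlgebra H renaming (refl to ≤-refl; trans to ≤-trans; reflexive to ≤-reflexive)
  open Lang L
  open IsSubreduct sub
  open MeetProperties meetSemilattice using (∧-monotonic; ∧-comm; ∧-assoc)
  open JoinProperties joinSemilattice using (∨-monotonic)
  open HeytingProperties H using (⇨-eval; ⇨-relax; ⇨-applyʳ; ∧-distribˡ-∨-≤)

  ℓ : Level
  ℓ = c ⊔ p ⊔ ℓ₁

  A : Set (c ⊔ p)
  A = El H sub

  ⌊_⌋ : A → Carrier
  ⌊_⌋ = proj₁

  _⊓_ : A → A → A
  _⊓_ = _∧A_ H sub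

  -- x ≤ y in the equational form used by IsFilter.
  _≲_ : Carrier → Carrier → Set ℓ₁
  x ≲ y = x ∧ y ≈ x

  ≲⇒≤ : ∀ {x y} → x ≲ y → x ≤ y
  ≲⇒≤ {x} {y} x∧y≈x = ≤-trans (≤-reflexive (Eq.sym x∧y≈x)) (x∧y≤y x y)

  ≤⇒≲ : ∀ {x y} → x ≤ y → x ≲ y
  ≤⇒≲ x≤y = antisym (x∧y≤x _ _) (∧-greatest ≤-refl x≤y)

  ∧-swap : ∀ {x y} → x ∧ y ≤ y ∧ x
  ∧-swap = ≤-reflexive (∧-comm _ _)

  ∧-bound-trans : ∀ {x y z y′ z′} → x ∧ y ≤ z → z ∧ y′ ≤ z′ → x ∧ (y ∧ y′) ≤ z′
  ∧-bound-trans x∧y≤z z∧y′≤z′ =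
    ≤-trans (≤-reflexive (Eq.sym (∧-assoc _ _ _))) (≤-trans (∧-monotonic x∧y≤z ≤-refl) z∧y′≤z′)

  Subset : Set (lsuc ℓ)
  Subset = SubA H sub

  Filter : Subset → Set ℓ
  Filter = IsFilter H sub

  filter-up : ∀ {F} → Filter F → ∀ {a b} → F a → ⌊ a ⌋ ≤ ⌊ b ⌋ → F b
  filter-up F-filter Fa a≤b = IsFilter.upset F-filter Fa (≤⇒≲ a≤b)

  Directed : Subset → Set (ℓ ⊔ ℓ₂)
  Directed D = ∀ d₁ d₂ → D d₁ → D d₂ → ∃ λ d → D d × ⌊ d₁ ⌋ ≤ ⌊ d ⌋ × ⌊ d₂ ⌋ ≤ ⌊ d ⌋

  Bottom : Subset
  Bottom u = Lift ℓ (⌊ u ⌋ ≈ ⊥)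

  bottom-directed : Directed Bottom
  bottom-directed d₁ _ d₁≈⊥ d₂≈⊥ =
    d₁ , d₁≈⊥ , ≤-refl , ≤-trans (≤-reflexive (lower d₂≈⊥)) (minimum ⌊ d₁ ⌋)

  Point : Set (lsuc ℓ)
  Point = Pt H sub

  ⟦_⟧ₚ : Point → Subset
  ⟦_⟧ₚ = proj₁

  _∈ₚ_ : A → Point → Set ℓ
  a ∈ₚ w = proj₁ w a

  _∉ₚ_ : A → Point → Set ℓ
  a ∉ₚ w = ¬ a ∈ₚ w

  _⊑ₚ_ : Point → Point → Set ℓ
  _⊑ₚ_ = _⊑_ H sub

  record MaximalAvoiding (T D : Subset) : Set (lsuc ℓ) where
    field
      point    : Point
      extends  : T ⊆ ⟦ point ⟧ₚ
      avoids   : ¬ (⟦ point ⟧ₚ ≬ D)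
      maximal  : ∀ {G} → Filter G → ⟦ point ⟧ₚ ⊆ G → ¬ (G ≬ D) → G ⊆ ⟦ point ⟧ₚ

  module _ {T D : Subset} (T-filter : Filter T) (T-avoids : ¬ (T ≬ D)) where

    AvoidingFilter : Set (lsuc ℓ)
    AvoidingFilter = Σ Subset λ F → Filter F × T ⊆ F × ¬ (F ≬ D)

    _≤ᶠ_ : Rel AvoidingFilter ℓ
    F ≤ᶠ G = proj₁ F ⊆ proj₁ G

    -- T is kept in the union so that the empty chain is bounded too.
    chain-bound : (C : Pred AvoidingFilter ℓ) → (∀ {F G} → C F → C G → F ≤ᶠ G ⊎ G ≤ᶠ F) →
                  ∃ λ U → ∀ {F} → C F → F ≤ᶠ U
    chain-bound C comparable = (U , U-filter , inj₁ , U-avoids) , λ CF Fa → inj₂ (resize lem (_ , CF , Fa))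
      where
        U : Subset
        U a = T a ⊎ Resize lem ℓ (∃ λ F → C F × proj₁ F a)

        U-filter : Filter U
        IsFilter.nonempty U-filter = let a , Ta = IsFilter.nonempty T-filter in a , inj₁ Ta
        IsFilter.upset U-filter (inj₁ Ta) a≲b = inj₁ (IsFilter.upset T-filter Ta a≲b)
        IsFilter.upset U-filter (inj₂ r) a≲b = let (F , F-filter , _) , CF , Fa = unresize lem r in
          inj₂ (resize lem (_ , CF , IsFilter.upset F-filter Fa a≲b))
        IsFilter.meet U-filter (inj₁ Ta) (inj₁ Tb) = inj₁ (IsFilter.meet T-filter Ta Tb)
        IsFilter.meet U-filter (inj₁ Ta) (inj₂ r) = let (F , F-filter , T⊆F , _) , CF , Fb = unresize lem r in
          inj₂ (resize lem (_ , CF , IsFilter.meet F-filter (T⊆F Ta) Fb))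
        IsFilter.meet U-filter (inj₂ r) (inj₁ Tb) = let (F , F-filter , T⊆F , _) , CF , Fa = unresize lem r in
          inj₂ (resize lem (_ , CF , IsFilter.meet F-filter Fa (T⊆F Tb)))
        IsFilter.meet U-filter (inj₂ r) (inj₂ s) with unresize lem r | unresize lem s
        ... | (F , CF , Fa) | (G , CG , Gb) with comparable CF CG
        ... | inj₁ F≤G = inj₂ (resize lem (G , CG , IsFilter.meet (proj₁ (proj₂ G)) (F≤G Fa) Gb))
        ... | inj₂ G≤F = inj₂ (resize lem (F , CF , IsFilter.meet (proj₁ (proj₂ F)) Fa (G≤F Gb)))

        U-avoids : ¬ (U ≬ D)
        U-avoids (_ , inj₁ Ta , Da) = T-avoids (_ , Ta , Da)
        U-avoids (_ , inj₂ r , Da) =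
          let (_ , _ , _ , F-avoids) , _ , Fa = unresize lem r in F-avoids (_ , Fa , Da)

    above-maximal-meets : (F : AvoidingFilter) → (∀ G → F ≤ᶠ G → G ≤ᶠ F) →
      ∀ {G} → Filter G → proj₁ F ⊆ G → ¬ (_≐_ H sub G (proj₁ F)) → G ≬ D
    above-maximal-meets (F , _ , T⊆F , _) F-max {G} G-filter F⊆G G≠F = em⇒dne lem λ G-avoids →
      G≠F λ a → (λ Ga → F-max (G , G-filter , (λ Ta → F⊆G (T⊆F Ta)) , G-avoids) F⊆G Ga) , F⊆G

    module _ {d₀ : A} (Dd₀ : D d₀) (D-directed : Directed D) where

      maximal⇒irreducible : (F : AvoidingFilter) → (∀ G → F ≤ᶠ G → G ≤ᶠ F) →
                            IsMeetIrreducible H sub (proj₁ F)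
      IsMeetIrreducible.proper (maximal⇒irreducible (_ , _ , _ , F-avoids) _) =
        d₀ , λ Fd₀ → F-avoids (d₀ , Fd₀ , Dd₀)
      IsMeetIrreducible.irreducible (maximal⇒irreducible F@(_ , _ , _ , F-avoids) F-max)
        (G , K , G-filter , K-filter , F≐G∩K , G≠F , K≠F) =
        let d₁ , Gd₁ , Dd₁ = above-maximal-meets F F-max G-filter (λ Fa → proj₁ (proj₁ (F≐G∩K _) Fa)) G≠F
            d₂ , Kd₂ , Dd₂ = above-maximal-meets F F-max K-filter (λ Fa → proj₂ (proj₁ (F≐G∩K _) Fa)) K≠F
            d , Dd , d₁≤d , d₂≤d = D-directed _ _ Dd₁ Dd₂
        in F-avoids (d , proj₂ (F≐G∩K d) (filter-up G-filter Gd₁ d₁≤d , filter-up K-filter Kd₂ d₂≤d) , Dd)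

      maximal-avoiding : MaximalAvoiding T D
      maximal-avoiding =
        from-maximum (zorn AvoidingFilter _≤ᶠ_ (λ Fa → Fa) (λ F≤G G≤K Fa → G≤K (F≤G Fa)) chain-bound)
        where
          from-maximum : (∃ λ F → ∀ G → F ≤ᶠ G → G ≤ᶠ F) → MaximalAvoiding T D
          from-maximum (F@(_ , F-filter , T⊆F , F-avoids) , F-max) = record
            { point   = _ , F-filter , maximal⇒irreducible F F-max
            ; extends = T⊆F
            ; avoids  = F-avoids
            ; maximal = λ G-filter F⊆G G-avoids →
                F-max (_ , G-filter , (λ Ta → F⊆G (T⊆F Ta)) , G-avoids) F⊆G
            }

  module _ (w : Point) where

    private
      w-filter : Filter ⟦ w ⟧ₚ
      w-filter = proj₁ (proj₂ w)

    ∈ₚ-up : ∀ {a b} → a ∈ₚ w → ⌊ a ⌋ ≤ ⌊ b ⌋ → b ∈ₚ w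
    ∈ₚ-up = filter-up w-filter

    ∈ₚ-⊓ : ∀ {a b} → a ∈ₚ w → b ∈ₚ w → (a ⊓ b) ∈ₚ w
    ∈ₚ-⊓ = IsFilter.meet w-filter

    ∃∈ₚ : ∃ λ a → a ∈ₚ w
    ∃∈ₚ = IsFilter.nonempty w-filter

    ∃∉ₚ : ∃ λ a → a ∉ₚ w
    ∃∉ₚ = IsMeetIrreducible.proper (proj₂ (proj₂ w))

    ≤⊥⇒∉ₚ : ∀ {a} → ⌊ a ⌋ ≤ ⊥ → a ∉ₚ w
    ≤⊥⇒∉ₚ a≤⊥ a∈w = let b , b∉w = ∃∉ₚ in
      b∉w (∈ₚ-up a∈w (≤-trans a≤⊥ (minimum ⌊ b ⌋)))

    adjoin : A → Subset
    adjoin a u = ∃ λ f → f ∈ₚ w × (⌊ a ⌋ ∧ ⌊ f ⌋) ≲ ⌊ u ⌋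

    adjoin-filter : ∀ a → Filter (adjoin a)
    IsFilter.nonempty (adjoin-filter a) = let f , f∈w = ∃∈ₚ in a ⊓ f , f , f∈w , ≤⇒≲ ≤-refl
    IsFilter.upset (adjoin-filter a) (f , f∈w , a∧f≲u) u≲v =
      f , f∈w , ≤⇒≲ (≤-trans (≲⇒≤ a∧f≲u) (≲⇒≤ u≲v))
    IsFilter.meet (adjoin-filter a) (f , f∈w , a∧f≲u) (g , g∈w , a∧g≲v) =
      f ⊓ g , ∈ₚ-⊓ f∈w g∈w , ≤⇒≲ (∧-greatest
        (≤-trans (∧-monotonic ≤-refl (x∧y≤x _ _)) (≲⇒≤ a∧f≲u))
        (≤-trans (∧-monotonic ≤-refl (x∧y≤y _ _)) (≲⇒≤ a∧g≲v)))

    ⊆-adjoin : ∀ a → ⟦ w ⟧ₚ ⊆ adjoin a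
    ⊆-adjoin a {u} u∈w = u , u∈w , ≤⇒≲ (x∧y≤y _ _)

    ∈-adjoin : ∀ a → adjoin a a
    ∈-adjoin a = let f , f∈w = ∃∈ₚ in f , f∈w , ≤⇒≲ (x∧y≤x _ _)

    -- If no such c existed, w would be the intersection of the two filters
    -- generated by w ∪ {a} and by w ∪ {b}.
    pair-bound : ∀ {a b} → a ∉ₚ w → b ∉ₚ w →
      ∃ λ c → c ∉ₚ w × ∃ λ f → f ∈ₚ w × ⌊ a ⌋ ∧ ⌊ f ⌋ ≤ ⌊ c ⌋ × ⌊ b ⌋ ∧ ⌊ f ⌋ ≤ ⌊ c ⌋
    pair-bound {a} {b} a∉w b∉w with lem {P = ∃ λ u → u ∉ₚ w × adjoin a u × adjoin b u}
    ... | yes (u , u∉w , (f , f∈w , a∧f≲u) , (g , g∈w , b∧g≲u)) =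
      u , u∉w , f ⊓ g , ∈ₚ-⊓ f∈w g∈w ,
      ≤-trans (∧-monotonic ≤-refl (x∧y≤x _ _)) (≲⇒≤ a∧f≲u) ,
      ≤-trans (∧-monotonic ≤-refl (x∧y≤y _ _)) (≲⇒≤ b∧g≲u)
    ... | no ¬common = ⊥-elim (IsMeetIrreducible.irreducible (proj₂ (proj₂ w))
          (adjoin a , adjoin b , adjoin-filter a , adjoin-filter b , w≐a∩b ,
           (λ eq → a∉w (proj₁ (eq a) (∈-adjoin a))) , (λ eq → b∉w (proj₁ (eq b) (∈-adjoin b)))))
      where
        w≐a∩b : _≐_ H sub ⟦ w ⟧ₚ (_∩_ H sub (adjoin a) (adjoin b))
        w≐a∩b u = (λ u∈w → ⊆-adjoin a u∈w , ⊆-adjoin b u∈w) ,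
                  λ (ua , ub) → em⇒dne lem λ u∉w → ¬common (u , u∉w , ua , ub)

    bound-outside : ∀ {x q} {X : Set x} (Q : X → A → Set q) (xs : List X) →
      All (λ x → ∃ λ a → Q x a × a ∉ₚ w) xs →
      ∃ λ c → c ∉ₚ w × ∃ λ f → f ∈ₚ w × All (λ x → ∃ λ a → Q x a × ⌊ a ⌋ ∧ ⌊ f ⌋ ≤ ⌊ c ⌋) xs
    bound-outside Q [] [] = let c , c∉w = ∃∉ₚ ; f , f∈w = ∃∈ₚ in c , c∉w , f , f∈w , []
    bound-outside Q (x ∷ xs) ((a , Qa , a∉w) ∷ outside) with bound-outside Q xs outside
    ... | c , c∉w , f , f∈w , bounds with pair-bound a∉w c∉w
    ... | c′ , c′∉w , f′ , f′∈w , a∧f′≤c′ , c∧f′≤c′ =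
      c′ , c′∉w , f ⊓ f′ , ∈ₚ-⊓ f∈w f′∈w ,
      (a , Qa , ≤-trans (∧-monotonic ≤-refl (x∧y≤y _ _)) a∧f′≤c′) ∷
      All.map (λ (b , Qb , b∧f≤c) → b , Qb , ∧-bound-trans b∧f≤c c∧f′≤c′) bounds

    ∨-prime : ∀ {a b j} → a ∉ₚ w → b ∉ₚ w → ⌊ j ⌋ ≤ ⌊ a ⌋ ∨ ⌊ b ⌋ → j ∉ₚ w
    ∨-prime {a} {b} {j} a∉w b∉w j≤a∨b j∈w with pair-bound a∉w b∉w
    ... | c , c∉w , f , f∈w , a∧f≤c , b∧f≤c = c∉w (∈ₚ-up (∈ₚ-⊓ j∈w f∈w) j∧f≤c)
      where
        j∧f≤c : ⌊ j ⌋ ∧ ⌊ f ⌋ ≤ ⌊ c ⌋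
        j∧f≤c = ≤-trans (∧-monotonic j≤a∨b ≤-refl) (≤-trans ∧-swap (≤-trans (∧-distribˡ-∨-≤ _ _ _)
                  (∨-least (≤-trans ∧-swap a∧f≤c) (≤-trans ∧-swap b∧f≤c))))

  IsMaximal : Point → Set (ℓ ⊔ ℓ₂)
  IsMaximal w = ∀ {b} → b ∉ₚ w → ∃ λ f → f ∈ₚ w × ⌊ b ⌋ ∧ ⌊ f ⌋ ≤ ⊥

  -- The three situations in which some element outside w lies in every one of
  -- finitely many points not below w.
  Separable : Point → List Point → Set (lsuc ℓ ⊔ ℓ₂)
  Separable w ws = has⇒ ≡ true ⊎ (has¬ ≡ true × IsMaximal w) ⊎ All (w ⊑ₚ_) ws

  module _ (w : Point) where

    separate : ∀ ws → All (λ w′ → ¬ w′ ⊑ₚ w) ws → Separable w ws →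
               ∃ λ s → s ∉ₚ w × All (s ∈ₚ_) ws
    separate ws ws⋢w separable
      with bound-outside w (λ w′ a → a ∈ₚ w′) ws (All.map (¬⊆⇒∃∉ lem) ws⋢w)
    ... | c , c∉w , f , f∈w , bounds with separable
    ... | inj₁ ⇒∈L =
      f⇨c , f⇨c∉w , All.map (λ {w′} (a , a∈w′ , a∧f≤c) → ∈ₚ-up w′ a∈w′ (transpose-⇨ a∧f≤c)) bounds
      where
        f⇨c : A
        f⇨c = ⌊ f ⌋ ⇨ ⌊ c ⌋ , ⇒-closed ⇒∈L (proj₂ f) (proj₂ c)
        f⇨c∉w : f⇨c ∉ₚ w
        f⇨c∉w f⇨c∈w = c∉w (∈ₚ-up w (∈ₚ-⊓ w f∈w f⇨c∈w) (⇨-applyʳ ≤-refl))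
    ... | inj₂ (inj₁ (¬∈L , maximal)) =
      let f′ , f′∈w , c∧f′≤⊥ = maximal c∉w
          m = f ⊓ f′
          ¬m : A
          ¬m = ⌊ m ⌋ ⇨ ⊥ , ¬-closed ¬∈L (proj₂ m)
      in ¬m , (λ ¬m∈w → ≤⊥⇒∉ₚ w (⇨-applyʳ {w = ⌊ m ⌋} ≤-refl) (∈ₚ-⊓ w (∈ₚ-⊓ w f∈w f′∈w) ¬m∈w)) ,
         All.map (λ {w′} (a , a∈w′ , a∧f≤c) → ∈ₚ-up w′ a∈w′ (transpose-⇨ (∧-bound-trans a∧f≤c c∧f′≤⊥))) bounds
    ... | inj₂ (inj₂ w⊑ws) =
      c , c∉w , All.zipWith (λ {w′} ((a , a∈w′ , a∧f≤c) , w⊑w′) → ∈ₚ-up w′ (∈ₚ-⊓ w′ a∈w′ (w⊑w′ f f∈w)) a∧f≤c)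
                            (bounds , w⊑ws)

  module _ {ρ ρ′ : ℕ → Carrier} (ρ≤ρ′ : ∀ i → ρ i ≤ ρ′ i) where

    evalH-mono⁺ : ∀ φ → Positive φ → evalH H φ ρ ≤ evalH H φ ρ′
    evalH-mono⁻ : ∀ φ → Negative φ → evalH H φ ρ′ ≤ evalH H φ ρ

    evalH-mono⁺ (var i)  _          = ρ≤ρ′ i
    evalH-mono⁺ (φ ∧ᶠ ψ) (φ⁺ , ψ⁺) = ∧-monotonic (evalH-mono⁺ φ φ⁺) (evalH-mono⁺ ψ ψ⁺)
    evalH-mono⁺ (φ ∨ᶠ ψ) (φ⁺ , ψ⁺) = ∨-monotonic (evalH-mono⁺ φ φ⁺) (evalH-mono⁺ ψ ψ⁺)
    evalH-mono⁺ (φ ⇒ᶠ ψ) (φ⁻ , ψ⁺) = ⇨-relax (evalH-mono⁻ φ φ⁻) (evalH-mono⁺ ψ ψ⁺)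
    evalH-mono⁺ (¬ᶠ φ)   φ⁻         = ⇨-relax (evalH-mono⁻ φ φ⁻) ≤-refl
    evalH-mono⁺ 𝟘        _          = ≤-refl
    evalH-mono⁺ 𝟙        _          = ≤-refl

    evalH-mono⁻ (φ ∧ᶠ ψ) (φ⁻ , ψ⁻) = ∧-monotonic (evalH-mono⁻ φ φ⁻) (evalH-mono⁻ ψ ψ⁻)
    evalH-mono⁻ (φ ∨ᶠ ψ) (φ⁻ , ψ⁻) = ∨-monotonic (evalH-mono⁻ φ φ⁻) (evalH-mono⁻ ψ ψ⁻)
    evalH-mono⁻ (φ ⇒ᶠ ψ) (φ⁺ , ψ⁻) = ⇨-relax (evalH-mono⁺ φ φ⁺) (evalH-mono⁻ ψ ψ⁻)
    evalH-mono⁻ (¬ᶠ φ)   φ⁺         = ⇨-relax (evalH-mono⁺ φ φ⁺) ≤-refl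
    evalH-mono⁻ 𝟘        _          = ≤-refl
    evalH-mono⁻ 𝟙        _          = ≤-refl

  evalH-occurs : ∀ φ {ρ ρ′ : ℕ → Carrier} → (∀ i → Occurs i φ → ρ i ≡ ρ′ i) → evalH H φ ρ ≡ evalH H φ ρ′
  evalH-occurs (var x)  ρ≡ρ′ = ρ≡ρ′ x refl
  evalH-occurs (φ ∧ᶠ ψ) ρ≡ρ′ =
    cong₂ _∧_ (evalH-occurs φ λ i o → ρ≡ρ′ i (inj₁ o)) (evalH-occurs ψ λ i o → ρ≡ρ′ i (inj₂ o))
  evalH-occurs (φ ∨ᶠ ψ) ρ≡ρ′ =
    cong₂ _∨_ (evalH-occurs φ λ i o → ρ≡ρ′ i (inj₁ o)) (evalH-occurs ψ λ i o → ρ≡ρ′ i (inj₂ o))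
  evalH-occurs (φ ⇒ᶠ ψ) ρ≡ρ′ =
    cong₂ _⇨_ (evalH-occurs φ λ i o → ρ≡ρ′ i (inj₁ o)) (evalH-occurs ψ λ i o → ρ≡ρ′ i (inj₂ o))
  evalH-occurs (¬ᶠ φ)   ρ≡ρ′ = cong (_⇨ ⊥) (evalH-occurs φ ρ≡ρ′)
  evalH-occurs 𝟘        _    = refl
  evalH-occurs 𝟙        _    = refl

  Assignment : Set (c ⊔ p)
  Assignment = ℕ → A

  _≤ᵍ_ : Assignment → Assignment → Set ℓ₂
  g ≤ᵍ g′ = ∀ i → ⌊ g i ⌋ ≤ ⌊ g′ i ⌋

  _⊓ᵍ_ : Assignment → Assignment → Assignment
  (g ⊓ᵍ g′) i = g i ⊓ g′ i

  ⊓ᵍ-≤ˡ : ∀ g g′ → (g ⊓ᵍ g′) ≤ᵍ g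
  ⊓ᵍ-≤ˡ g g′ i = x∧y≤x _ _

  ⊓ᵍ-≤ʳ : ∀ g g′ → (g ⊓ᵍ g′) ≤ᵍ g′
  ⊓ᵍ-≤ʳ g g′ i = x∧y≤y _ _

  evalH-closed : ∀ {φ} → InLang L φ → (g : Assignment) → P (evalH H φ (⌊_⌋ ∘ g))
  evalH-closed {var x}  _              g = proj₂ (g x)
  evalH-closed {φ ∧ᶠ ψ} (φ∈L , ψ∈L)     g = ∧-closed (evalH-closed φ∈L g) (evalH-closed ψ∈L g)
  evalH-closed {φ ∨ᶠ ψ} (∨∈L , φ∈L , ψ∈L) g = ∨-closed ∨∈L (evalH-closed φ∈L g) (evalH-closed ψ∈L g)
  evalH-closed {φ ⇒ᶠ ψ} (⇒∈L , φ∈L , ψ∈L) g = ⇒-closed ⇒∈L (evalH-closed φ∈L g) (evalH-closed ψ∈L g)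
  evalH-closed {¬ᶠ φ}   (¬∈L , φ∈L)     g = ¬-closed ¬∈L (evalH-closed φ∈L g)
  evalH-closed {𝟘}      𝟘∈L            g = 𝟘-closed 𝟘∈L
  evalH-closed {𝟙}      𝟙∈L            g = 𝟙-closed 𝟙∈L

  evalA : ∀ φ → InLang L φ → Assignment → A
  evalA φ φ∈L g = evalH H φ (⌊_⌋ ∘ g) , evalH-closed φ∈L g

  evalAll : ∀ φs → All (InLang L) φs → Assignment → List A
  evalAll []       []            g = []
  evalAll (φ ∷ φs) (φ∈L ∷ φs∈L) g = evalA φ φ∈L g ∷ evalAll φs φs∈L g

  Valuation : Set (lsuc (lsuc ℓ))
  Valuation = ℕ → UpSet H sub

  ⟦_⟧ᵘ : Fm → Valuation → Point → Set (lsuc ℓ)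
  ⟦_⟧ᵘ = evalU H sub

  _⊆ᵛ_ : Valuation → Valuation → Set (lsuc ℓ)
  V ⊆ᵛ V′ = ∀ i {w} → proj₁ (V i) w → proj₁ (V′ i) w

  module _ {V V′ : Valuation} (V⊆V′ : V ⊆ᵛ V′) where

    evalU-mono⁺ : ∀ φ → Positive φ → ∀ {w} → ⟦ φ ⟧ᵘ V w → ⟦ φ ⟧ᵘ V′ w
    evalU-mono⁻ : ∀ φ → Negative φ → ∀ {w} → ⟦ φ ⟧ᵘ V′ w → ⟦ φ ⟧ᵘ V w

    evalU-mono⁺ (var i)  _          wi        = V⊆V′ i wi
    evalU-mono⁺ (φ ∧ᶠ ψ) (φ⁺ , ψ⁺) (wφ , wψ) = evalU-mono⁺ φ φ⁺ wφ , evalU-mono⁺ ψ ψ⁺ wψ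
    evalU-mono⁺ (φ ∨ᶠ ψ) (φ⁺ , _)  (inj₁ wφ) = inj₁ (evalU-mono⁺ φ φ⁺ wφ)
    evalU-mono⁺ (φ ∨ᶠ ψ) (_ , ψ⁺)  (inj₂ wψ) = inj₂ (evalU-mono⁺ ψ ψ⁺ wψ)
    evalU-mono⁺ (φ ⇒ᶠ ψ) (φ⁻ , ψ⁺) wφ⇒ψ (u , w⊑u , uφ , ¬uψ) =
      wφ⇒ψ (u , w⊑u , evalU-mono⁻ φ φ⁻ uφ , λ uψ → ¬uψ (evalU-mono⁺ ψ ψ⁺ uψ))
    evalU-mono⁺ (¬ᶠ φ)   φ⁻ w¬φ (u , w⊑u , uφ , u∉∅) = w¬φ (u , w⊑u , evalU-mono⁻ φ φ⁻ uφ , u∉∅)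
    evalU-mono⁺ 𝟘        _  w∈∅ = w∈∅
    evalU-mono⁺ 𝟙        _  w∈X = w∈X

    evalU-mono⁻ (φ ∧ᶠ ψ) (φ⁻ , ψ⁻) (wφ , wψ) = evalU-mono⁻ φ φ⁻ wφ , evalU-mono⁻ ψ ψ⁻ wψ
    evalU-mono⁻ (φ ∨ᶠ ψ) (φ⁻ , _)  (inj₁ wφ) = inj₁ (evalU-mono⁻ φ φ⁻ wφ)
    evalU-mono⁻ (φ ∨ᶠ ψ) (_ , ψ⁻)  (inj₂ wψ) = inj₂ (evalU-mono⁻ ψ ψ⁻ wψ)
    evalU-mono⁻ (φ ⇒ᶠ ψ) (φ⁺ , ψ⁻) wφ⇒ψ (u , w⊑u , uφ , ¬uψ) =
      wφ⇒ψ (u , w⊑u , evalU-mono⁺ φ φ⁺ uφ , λ uψ → ¬uψ (evalU-mono⁻ ψ ψ⁻ uψ))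
    evalU-mono⁻ (¬ᶠ φ)   φ⁺ w¬φ (u , w⊑u , uφ , u∉∅) = w¬φ (u , w⊑u , evalU-mono⁺ φ φ⁺ uφ , u∉∅)
    evalU-mono⁻ 𝟘        _  w∈∅ = w∈∅
    evalU-mono⁻ 𝟙        _  w∈X = w∈X

  module Countermodel (x₀ : Point) (V : Valuation) where

    -- R i lists the points that must contain the value of the variable i.
    Requirement : Set (lsuc ℓ)
    Requirement = ℕ → List Point

    Valid : Requirement → Set (lsuc ℓ)
    Valid R = ∀ i → All (λ w → x₀ ⊑ₚ w × proj₁ (V i) w) (R i)

    Realises : Requirement → Assignment → Set (lsuc ℓ)
    Realises R g = ∀ i → All (g i ∈ₚ_) (R i)

    _⊒_ : Requirement → Requirement → Set (lsuc ℓ)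
    R ⊒ R′ = ∀ {g} → Realises R g → Realises R′ g

    _∪ʳ_ : Requirement → Requirement → Requirement
    (R₁ ∪ʳ R₂) i = R₁ i ++ R₂ i

    ⟨_↦_⟩ : ℕ → Point → Requirement
    ⟨ i ↦ w ⟩ j with j ≟ i
    ... | yes _ = w ∷ []
    ... | no  _ = []

    valid-∪ʳ : ∀ {R₁ R₂} → Valid R₁ → Valid R₂ → Valid (R₁ ∪ʳ R₂)
    valid-∪ʳ R₁-valid R₂-valid i = ++⁺ (R₁-valid i) (R₂-valid i)

    ⊒-∪ʳ⁻ˡ : ∀ {R R₁ R₂} → R ⊒ (R₁ ∪ʳ R₂) → R ⊒ R₁
    ⊒-∪ʳ⁻ˡ {R₁ = R₁} R⊒R₁∪R₂ g-realises i = ++⁻ˡ (R₁ i) (R⊒R₁∪R₂ g-realises i)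

    ⊒-∪ʳ⁻ʳ : ∀ {R R₁ R₂} → R ⊒ (R₁ ∪ʳ R₂) → R ⊒ R₂
    ⊒-∪ʳ⁻ʳ {R₁ = R₁} R⊒R₁∪R₂ g-realises i = ++⁻ʳ (R₁ i) (R⊒R₁∪R₂ g-realises i)

    valid-⟨↦⟩ : ∀ {i w} → x₀ ⊑ₚ w → proj₁ (V i) w → Valid ⟨ i ↦ w ⟩
    valid-⟨↦⟩ {i} x₀⊑w w∈Vi j with j ≟ i
    ... | yes refl = (x₀⊑w , w∈Vi) ∷ []
    ... | no  _    = []

    realises-⟨↦⟩ : ∀ {i w g} → Realises ⟨ i ↦ w ⟩ g → g i ∈ₚ w
    realises-⟨↦⟩ {i} g-realises with i ≟ i | g-realises i
    ... | yes _   | gi∈w ∷ [] = gi∈w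
    ... | no  i≢i | _         = ⊥-elim (i≢i refl)

    e₀ : A
    e₀ = proj₁ (∃∈ₚ x₀)

    g₀ : Assignment
    g₀ _ = e₀

    realises-g₀ : ∀ {R} → Valid R → Realises R g₀
    realises-g₀ R-valid i = All.map (λ (x₀⊑w , _) → x₀⊑w e₀ (proj₂ (∃∈ₚ x₀))) (R-valid i)

    realises-⊓ᵍ : ∀ {R g g′} → Realises R g → Realises R g′ → Realises R (g ⊓ᵍ g′)
    realises-⊓ᵍ g-realises g′-realises i =
      All.zipWith (λ {w} (gi∈w , g′i∈w) → ∈ₚ-⊓ w gi∈w g′i∈w) (g-realises i , g′-realises i)

    realises-[↦] : ∀ {R g i s} → Realises R g → All (s ∈ₚ_) (R i) → Realises R (g [ i ↦ s ])
    realises-[↦] {i = i} g-realises s∈Ri j with j ≟ i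
    ... | yes refl = s∈Ri
    ... | no  _    = g-realises j

    V₀ : Requirement → Valuation
    V₀ R i = (λ w → Any (_⊑ₚ w) (R i)) ,
             λ w⊑w′ → Any.map λ u⊑w a a∈u → w⊑w′ a (u⊑w a a∈u)

    V₀⊆V : ∀ {R} → Valid R → V₀ R ⊆ᵛ V
    V₀⊆V R-valid i some-u⊑w = let (_ , u∈Vi) , u⊑w = All.lookupAny (R-valid i) some-u⊑w in
      proj₂ (V i) u⊑w u∈Vi

    Eventually : ∀ {q} → Requirement → (Assignment → Set q) → Set (lsuc ℓ ⊔ ℓ₂ ⊔ q)
    Eventually R Q = ∃ λ g₀ → Realises R g₀ × (∀ {g} → Realises R g → g ≤ᵍ g₀ → Q g)

    module _ {R : Requirement} where

      eventually-× : ∀ {q q′} {Q : Assignment → Set q} {Q′ : Assignment → Set q′} →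
                     Eventually R Q → Eventually R Q′ → Eventually R (λ g → Q g × Q′ g)
      eventually-× (g₁ , g₁-realises , Q-below) (g₂ , g₂-realises , Q′-below) =
        g₁ ⊓ᵍ g₂ , realises-⊓ᵍ g₁-realises g₂-realises ,
        λ g-realises g≤ → Q-below g-realises (λ i → ≤-trans (g≤ i) (x∧y≤x _ _)) ,
                          Q′-below g-realises (λ i → ≤-trans (g≤ i) (x∧y≤y _ _))

      eventually-map : ∀ {q q′} {Q : Assignment → Set q} {Q′ : Assignment → Set q′} →
                       (∀ {g} → Q g → Q′ g) → Eventually R Q → Eventually R Q′
      eventually-map Q⇒Q′ (g₀ , g₀-realises , Q-below) =
        g₀ , g₀-realises , λ g-realises g≤ → Q⇒Q′ (Q-below g-realises g≤)

      eventually-always : ∀ {q} {Q : Assignment → Set q} → Valid R → (∀ {g} → Q g) → Eventually R Q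
      eventually-always R-valid Q-always = g₀ , realises-g₀ R-valid , λ _ _ → Q-always

      eventually-witness : ∀ {q} {Q : Assignment → Set q} → Eventually R Q → ∃ λ g → Realises R g × Q g
      eventually-witness (g₀ , g₀-realises , Q-below) = g₀ , g₀-realises , Q-below g₀-realises (λ _ → ≤-refl)

      negative-eventually : ∀ ν → Negative ν → (ν∈L : InLang L ν) → ∀ {w} →
        (∃ λ g → Realises R g × evalA ν ν∈L g ∈ₚ w) → Eventually R (λ g → evalA ν ν∈L g ∈ₚ w)
      negative-eventually ν ν⁻ ν∈L {w} (g₀ , g₀-realises , ν∈w) =
        g₀ , g₀-realises , λ _ g≤g₀ → ∈ₚ-up w ν∈w (evalH-mono⁻ g≤g₀ ν ν⁻)

    record Forced {q} (Q : Assignment → Set q) : Set (lsuc (lsuc ℓ) ⊔ ℓ₂ ⊔ q) where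
      field
        requirement : Requirement
        valid       : Valid requirement
        eventually  : ∀ {R} → Valid R → R ⊒ requirement → Eventually R Q

    module _ {q} {Q : Assignment → Set q} where

      forced-× : ∀ {q′} {Q′ : Assignment → Set q′} → Forced Q → Forced Q′ → Forced (λ g → Q g × Q′ g)
      forced-× Q-forced Q′-forced = record
        { requirement = requirement Q-forced ∪ʳ requirement Q′-forced
        ; valid       = valid-∪ʳ (valid Q-forced) (valid Q′-forced)
        ; eventually  = λ R-valid R⊒ → eventually-×
            (eventually Q-forced R-valid (⊒-∪ʳ⁻ˡ R⊒)) (eventually Q′-forced R-valid (⊒-∪ʳ⁻ʳ R⊒))
        }
        where open Forced

      forced-map : ∀ {q′} {Q′ : Assignment → Set q′} → (∀ {g} → Q g → Q′ g) → Forced Q → Forced Q′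
      forced-map Q⇒Q′ Q-forced = record
        { requirement = requirement
        ; valid       = valid
        ; eventually  = λ R-valid R⊒ → eventually-map Q⇒Q′ (eventually R-valid R⊒)
        }
        where open Forced Q-forced

      forced-everywhere : (∀ {R} → Valid R → Eventually R Q) → Forced Q
      forced-everywhere Q-eventually = record
        { requirement = λ _ → []
        ; valid       = λ _ → []
        ; eventually  = λ R-valid _ → Q-eventually R-valid
        }

      forced-witness : Forced Q → ∃ Q
      forced-witness Q-forced =
        let g , _ , Qg = eventually-witness (eventually valid (λ realises → realises)) in g , Qg
        where open Forced Q-forced

    module Minimal {R : Requirement} (R-valid : Valid R) where

      adjoin-values : Point → ∀ γ → InLang L γ → Subset
      adjoin-values w γ γ∈L u =
        ∃ λ a → a ∈ₚ w × ∃ λ g → Resize lem ℓ (Realises R g) × (⌊ a ⌋ ∧ ⌊ evalA γ γ∈L g ⌋) ≲ ⌊ u ⌋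

      adjoin-values-filter : ∀ w γ → Positive γ → ∀ γ∈L → Filter (adjoin-values w γ γ∈L)
      IsFilter.nonempty (adjoin-values-filter w γ _ γ∈L) =
        let a , a∈w = ∃∈ₚ w in
        a ⊓ evalA γ γ∈L g₀ , a , a∈w , g₀ , resize lem (realises-g₀ R-valid) , ≤⇒≲ ≤-refl
      IsFilter.upset (adjoin-values-filter w γ _ γ∈L) (a , a∈w , g , g-realises , a∧γ≲u) u≲v =
        a , a∈w , g , g-realises , ≤⇒≲ (≤-trans (≲⇒≤ a∧γ≲u) (≲⇒≤ u≲v))
      IsFilter.meet (adjoin-values-filter w γ γ⁺ γ∈L)
        (a₁ , a₁∈w , g₁ , g₁-realises , a₁∧γ₁≲u₁) (a₂ , a₂∈w , g₂ , g₂-realises , a₂∧γ₂≲u₂) =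
        a₁ ⊓ a₂ , ∈ₚ-⊓ w a₁∈w a₂∈w , g₁ ⊓ᵍ g₂ ,
        resize lem (realises-⊓ᵍ (unresize lem g₁-realises) (unresize lem g₂-realises)) ,
        ≤⇒≲ (∧-greatest
          (≤-trans (∧-monotonic (x∧y≤x _ _) (evalH-mono⁺ (⊓ᵍ-≤ˡ g₁ g₂) γ γ⁺)) (≲⇒≤ a₁∧γ₁≲u₁))
          (≤-trans (∧-monotonic (x∧y≤y _ _) (evalH-mono⁺ (⊓ᵍ-≤ʳ g₁ g₂) γ γ⁺)) (≲⇒≤ a₂∧γ₂≲u₂)))

      ⊆-adjoin-values : ∀ w γ γ∈L → ⟦ w ⟧ₚ ⊆ adjoin-values w γ γ∈L
      ⊆-adjoin-values w γ γ∈L {a} a∈w = a , a∈w , g₀ , resize lem (realises-g₀ R-valid) , ≤⇒≲ (x∧y≤x _ _)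

      value-∈-adjoin-values : ∀ w γ γ∈L {g} → Realises R g → adjoin-values w γ γ∈L (evalA γ γ∈L g)
      value-∈-adjoin-values w γ γ∈L {g} g-realises =
        let a , a∈w = ∃∈ₚ w in a , a∈w , g , resize lem g-realises , ≤⇒≲ (x∧y≤y _ _)

      below-values : ∀ δ → InLang L δ → Subset
      below-values δ δ∈L u = ∃ λ g → Resize lem ℓ (Realises R g) × ⌊ u ⌋ ≲ ⌊ evalA δ δ∈L g ⌋

      below-values-directed : ∀ δ → Negative δ → ∀ δ∈L → Directed (below-values δ δ∈L)
      below-values-directed δ δ⁻ δ∈L _ _ (g₁ , g₁-realises , d₁≲δ) (g₂ , g₂-realises , d₂≲δ) =
        evalA δ δ∈L (g₁ ⊓ᵍ g₂) ,
        (g₁ ⊓ᵍ g₂ , resize lem (realises-⊓ᵍ (unresize lem g₁-realises) (unresize lem g₂-realises)) ,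
         ≤⇒≲ ≤-refl) ,
        ≤-trans (≲⇒≤ d₁≲δ) (evalH-mono⁻ (⊓ᵍ-≤ˡ g₁ g₂) δ δ⁻) ,
        ≤-trans (≲⇒≤ d₂≲δ) (evalH-mono⁻ (⊓ᵍ-≤ʳ g₁ g₂) δ δ⁻)

      positive-fails : ∀ β → Positive β → (β∈L : InLang L β) → ∀ {w} → (∀ i → Separable w (R i)) →
        ¬ ⟦ β ⟧ᵘ (V₀ R) w → Eventually R (λ g → evalA β β∈L g ∉ₚ w)
      negative-holds : ∀ ν → Negative ν → (ν∈L : InLang L ν) → ∀ {w} →
        ⟦ ν ⟧ᵘ (V₀ R) w → Eventually R (λ g → evalA ν ν∈L g ∈ₚ w)
      positive-holds : ∀ γ → Positive γ → (γ∈L : InLang L γ) → ∀ {w} → (∀ i → Separable w (R i)) →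
        (∀ {g} → Realises R g → evalA γ γ∈L g ∈ₚ w) → ⟦ γ ⟧ᵘ (V₀ R) w
      ⇒-refutation : ∀ γ δ → Positive γ → Negative δ →
        (⇒∈L : has⇒ ≡ true) (γ∈L : InLang L γ) (δ∈L : InLang L δ) →
        ∀ {w} → ¬ (∃ λ g → Realises R g × evalA (γ ⇒ᶠ δ) (⇒∈L , γ∈L , δ∈L) g ∈ₚ w) →
        ∃ λ u → w ⊑ₚ u × ⟦ γ ⟧ᵘ (V₀ R) u × ¬ ⟦ δ ⟧ᵘ (V₀ R) u
      ¬-refutation : ∀ γ → Positive γ → (¬∈L : has¬ ≡ true) (γ∈L : InLang L γ) →
        ∀ {w} → ¬ (∃ λ g → Realises R g × evalA (¬ᶠ γ) (¬∈L , γ∈L) g ∈ₚ w) →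
        ∃ λ u → w ⊑ₚ u × ⟦ γ ⟧ᵘ (V₀ R) u

      positive-fails (var i) _ _ {w} separable w⊭i =
        let s , s∉w , s∈Ri = separate w (R i) (¬Any⇒All¬ (R i) w⊭i) (separable i) in
        g₀ [ i ↦ s ] , realises-[↦] (realises-g₀ R-valid) s∈Ri , λ {g} _ g≤ gi∈w →
        s∉w (∈ₚ-up w gi∈w (subst (λ t → ⌊ g i ⌋ ≤ ⌊ t ⌋) ([↦]-≡ g₀ i s) (g≤ i)))
      positive-fails (β₁ ∧ᶠ β₂) (β₁⁺ , β₂⁺) (β₁∈L , β₂∈L) {w} separable w⊭β with ¬×⇒¬⊎¬ lem w⊭β
      ... | inj₁ w⊭β₁ = eventually-map (λ β₁∉w β∈w → β₁∉w (∈ₚ-up w β∈w (x∧y≤x _ _)))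
                          (positive-fails β₁ β₁⁺ β₁∈L separable w⊭β₁)
      ... | inj₂ w⊭β₂ = eventually-map (λ β₂∉w β∈w → β₂∉w (∈ₚ-up w β∈w (x∧y≤y _ _)))
                          (positive-fails β₂ β₂⁺ β₂∈L separable w⊭β₂)
      positive-fails (β₁ ∨ᶠ β₂) (β₁⁺ , β₂⁺) (_ , β₁∈L , β₂∈L) {w} separable w⊭β =
        eventually-map (λ (β₁∉w , β₂∉w) → ∨-prime w β₁∉w β₂∉w ≤-refl)
          (eventually-× (positive-fails β₁ β₁⁺ β₁∈L separable (w⊭β ∘ inj₁))
                        (positive-fails β₂ β₂⁺ β₂∈L separable (w⊭β ∘ inj₂)))
      positive-fails (γ ⇒ᶠ δ) (γ⁻ , δ⁺) (⇒∈L , γ∈L , δ∈L) _ w⊭γ⇒δ =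
        let u , w⊑u , u⊨γ , u⊭δ = em⇒dne lem w⊭γ⇒δ in
        eventually-map (λ (γ∈u , δ∉u) γ⇒δ∈w → δ∉u (∈ₚ-up u (∈ₚ-⊓ u (w⊑u _ γ⇒δ∈w) γ∈u) ⇨-eval))
          (eventually-× (negative-holds γ γ⁻ γ∈L u⊨γ) (positive-fails δ δ⁺ δ∈L (λ _ → inj₁ ⇒∈L) u⊭δ))
      positive-fails (¬ᶠ γ) γ⁻ (_ , γ∈L) _ w⊭¬γ =
        let u , w⊑u , u⊨γ , _ = em⇒dne lem w⊭¬γ in
        eventually-map (λ γ∈u ¬γ∈w → ≤⊥⇒∉ₚ u ⇨-eval (∈ₚ-⊓ u (w⊑u _ ¬γ∈w) γ∈u))
          (negative-holds γ γ⁻ γ∈L u⊨γ)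
      positive-fails 𝟘 _ _ {w} _ _ = eventually-always R-valid (≤⊥⇒∉ₚ w ≤-refl)
      positive-fails 𝟙 _ _ _ w⊭𝟙 = ⊥-elim (w⊭𝟙 (lift tt))

      negative-holds (ν₁ ∧ᶠ ν₂) (ν₁⁻ , ν₂⁻) (ν₁∈L , ν₂∈L) {w} (w⊨ν₁ , w⊨ν₂) =
        eventually-map (λ (ν₁∈w , ν₂∈w) → ∈ₚ-⊓ w ν₁∈w ν₂∈w)
          (eventually-× (negative-holds ν₁ ν₁⁻ ν₁∈L w⊨ν₁) (negative-holds ν₂ ν₂⁻ ν₂∈L w⊨ν₂))
      negative-holds (ν₁ ∨ᶠ ν₂) (ν₁⁻ , _) (_ , ν₁∈L , _) {w} (inj₁ w⊨ν₁) =
        eventually-map (λ ν₁∈w → ∈ₚ-up w ν₁∈w (x≤x∨y _ _)) (negative-holds ν₁ ν₁⁻ ν₁∈L w⊨ν₁)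
      negative-holds (ν₁ ∨ᶠ ν₂) (_ , ν₂⁻) (_ , _ , ν₂∈L) {w} (inj₂ w⊨ν₂) =
        eventually-map (λ ν₂∈w → ∈ₚ-up w ν₂∈w (y≤x∨y _ _)) (negative-holds ν₂ ν₂⁻ ν₂∈L w⊨ν₂)
      negative-holds (γ ⇒ᶠ δ) ν⁻@(γ⁺ , δ⁻) ν∈L@(⇒∈L , γ∈L , δ∈L) {w} w⊨ν =
        negative-eventually {R} (γ ⇒ᶠ δ) ν⁻ ν∈L {w}
          (em⇒dne lem (w⊨ν ∘ ⇒-refutation γ δ γ⁺ δ⁻ ⇒∈L γ∈L δ∈L {w}))
      negative-holds (¬ᶠ γ) γ⁺ ν∈L@(¬∈L , γ∈L) {w} w⊨ν =
        negative-eventually {R} (¬ᶠ γ) γ⁺ ν∈L {w}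
          (em⇒dne lem λ no-witness → let u , w⊑u , u⊨γ = ¬-refutation γ γ⁺ ¬∈L γ∈L {w} no-witness in
                                     w⊨ν (u , w⊑u , u⊨γ , lower))
      negative-holds 𝟙 _ _ {w} _ =
        eventually-always R-valid (let a , a∈w = ∃∈ₚ w in ∈ₚ-up w a∈w (maximum _))

      positive-holds γ γ⁺ γ∈L separable γ∈w = em⇒dne lem λ w⊭γ →
        let _ , g-realises , γ∉w = eventually-witness (positive-fails γ γ⁺ γ∈L separable w⊭γ) in
        γ∉w (γ∈w g-realises)

      ⇒-refutation γ δ γ⁺ δ⁻ ⇒∈L γ∈L δ∈L {w} no-witness =
        point , (λ _ a∈w → extends (⊆-adjoin-values w γ γ∈L a∈w)) ,
        positive-holds γ γ⁺ γ∈L (λ _ → inj₁ ⇒∈L) (extends ∘ value-∈-adjoin-values w γ γ∈L) ,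
        point⊭δ
        where
          values-avoid : ¬ (adjoin-values w γ γ∈L ≬ below-values δ δ∈L)
          values-avoid (_ , (a , a∈w , g₁ , g₁-realises , a∧γ≲u) , (g₂ , g₂-realises , u≲δ)) =
            no-witness (g₁ ⊓ᵍ g₂ , realises-⊓ᵍ (unresize lem g₁-realises) (unresize lem g₂-realises) ,
                        ∈ₚ-up w a∈w (transpose-⇨ a∧γ≤δ))
            where
              a∧γ≤δ : ⌊ a ⌋ ∧ ⌊ evalA γ γ∈L (g₁ ⊓ᵍ g₂) ⌋ ≤ ⌊ evalA δ δ∈L (g₁ ⊓ᵍ g₂) ⌋
              a∧γ≤δ = ≤-trans (∧-monotonic ≤-refl (evalH-mono⁺ (⊓ᵍ-≤ˡ g₁ g₂) γ γ⁺))
                        (≤-trans (≲⇒≤ a∧γ≲u) (≤-trans (≲⇒≤ u≲δ) (evalH-mono⁻ (⊓ᵍ-≤ʳ g₁ g₂) δ δ⁻)))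

          extension : MaximalAvoiding (adjoin-values w γ γ∈L) (below-values δ δ∈L)
          extension = maximal-avoiding (adjoin-values-filter w γ γ⁺ γ∈L) values-avoid
            {d₀ = evalA δ δ∈L g₀} (g₀ , resize lem (realises-g₀ R-valid) , ≤⇒≲ ≤-refl)
            (below-values-directed δ δ⁻ δ∈L)

          open MaximalAvoiding extension

          point⊭δ : ¬ ⟦ δ ⟧ᵘ (V₀ R) point
          point⊭δ point⊨δ =
            let g , g-realises , δ∈point = eventually-witness (negative-holds δ δ⁻ δ∈L point⊨δ) in
            avoids (_ , δ∈point , g , resize lem g-realises , ≤⇒≲ ≤-refl)

      ¬-refutation γ γ⁺ ¬∈L γ∈L {w} no-witness =
        point , (λ _ a∈w → extends (⊆-adjoin-values w γ γ∈L a∈w)) ,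
        positive-holds γ γ⁺ γ∈L (λ _ → inj₂ (inj₁ (¬∈L , point-maximal)))
          (extends ∘ value-∈-adjoin-values w γ γ∈L)
        where
          a₀ : A
          a₀ = proj₁ (∃∈ₚ w)

          a₀∧¬a₀ : A
          a₀∧¬a₀ = a₀ ⊓ (⌊ a₀ ⌋ ⇨ ⊥ , ¬-closed ¬∈L (proj₂ a₀))

          values-avoid : ¬ (adjoin-values w γ γ∈L ≬ Bottom)
          values-avoid (_ , (a , a∈w , g , g-realises , a∧γ≲u) , u≈⊥) =
            no-witness (g , unresize lem g-realises ,
                        ∈ₚ-up w a∈w (transpose-⇨ (≤-trans (≲⇒≤ a∧γ≲u) (≤-reflexive (lower u≈⊥)))))

          extension : MaximalAvoiding (adjoin-values w γ γ∈L) Bottom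
          extension = maximal-avoiding (adjoin-values-filter w γ γ⁺ γ∈L) values-avoid
            {d₀ = a₀∧¬a₀} (lift (antisym (⇨-applyʳ ≤-refl) (minimum _)))
            bottom-directed

          open MaximalAvoiding extension

          -- Avoiding ⊥ makes the point maximal, which is what allows separating variables by ¬.
          point-maximal : IsMaximal point
          point-maximal {b} b∉point = em⇒dne lem λ no-complement →
            b∉point (maximal (adjoin-filter point b) (⊆-adjoin point b)
                             (λ (_ , (f , f∈point , b∧f≲u) , u≈⊥) → no-complement
                                (f , f∈point , ≤-trans (≲⇒≤ b∧f≲u) (≤-reflexive (lower u≈⊥))))
                             (∈-adjoin point b))

    open Minimal using (positive-fails; negative-holds)

    antecedent-holds : ∀ α → SahlAnt α → (α∈L : InLang L α) → ∀ {w} → x₀ ⊑ₚ w → ⟦ α ⟧ᵘ V w →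
                       Forced (λ g → evalA α α∈L g ∈ₚ w)
    antecedent-holds (var i) (ant-var .i) _ {w} x₀⊑w w∈Vi = record
      { requirement = ⟨ i ↦ w ⟩
      ; valid       = valid-⟨↦⟩ x₀⊑w w∈Vi
      ; eventually  = λ R-valid R⊒ → g₀ , realises-g₀ R-valid , λ g-realises _ → realises-⟨↦⟩ (R⊒ g-realises)
      }
    antecedent-holds α (ant-neg α⁻) α∈L _ w⊨α = forced-everywhere λ R-valid →
      negative-holds R-valid α α⁻ α∈L (evalU-mono⁻ (V₀⊆V R-valid) α α⁻ w⊨α)
    antecedent-holds 𝟙 ant-𝟙 _ {w} _ _ = forced-everywhere λ R-valid →
      eventually-always R-valid (let a , a∈w = ∃∈ₚ w in ∈ₚ-up w a∈w (maximum _))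
    antecedent-holds (α₁ ∧ᶠ α₂) (ant-∧ α₁-ant α₂-ant) (α₁∈L , α₂∈L) {w} x₀⊑w (w⊨α₁ , w⊨α₂) =
      forced-map (λ (α₁∈w , α₂∈w) → ∈ₚ-⊓ w α₁∈w α₂∈w)
        (forced-× (antecedent-holds α₁ α₁-ant α₁∈L x₀⊑w w⊨α₁) (antecedent-holds α₂ α₂-ant α₂∈L x₀⊑w w⊨α₂))
    antecedent-holds (α₁ ∨ᶠ α₂) (ant-∨ α₁-ant _) (_ , α₁∈L , _) {w} x₀⊑w (inj₁ w⊨α₁) =
      forced-map (λ α₁∈w → ∈ₚ-up w α₁∈w (x≤x∨y _ _)) (antecedent-holds α₁ α₁-ant α₁∈L x₀⊑w w⊨α₁)
    antecedent-holds (α₁ ∨ᶠ α₂) (ant-∨ _ α₂-ant) (_ , _ , α₂∈L) {w} x₀⊑w (inj₂ w⊨α₂) =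
      forced-map (λ α₂∈w → ∈ₚ-up w α₂∈w (y≤x∨y _ _)) (antecedent-holds α₂ α₂-ant α₂∈L x₀⊑w w⊨α₂)

    positive-fails-forced : ∀ β → Positive β → (β∈L : InLang L β) → ∀ {w} →
      (∀ {R} → Valid R → ∀ i → Separable w (R i)) → ¬ ⟦ β ⟧ᵘ V w → Forced (λ g → evalA β β∈L g ∉ₚ w)
    positive-fails-forced β β⁺ β∈L separable w⊭β = forced-everywhere λ R-valid →
      positive-fails R-valid β β⁺ β∈L (separable R-valid) (w⊭β ∘ evalU-mono⁺ (V₀⊆V R-valid) β β⁺)

    body-fails : ∀ φ → SahlBody φ → (φ∈L : InLang L φ) → ¬ ⟦ φ ⟧ᵘ V x₀ → Forced (λ g → evalA φ φ∈L g ∉ₚ x₀)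
    body-fails (φ₁ ∧ᶠ φ₂) (body-∧ φ₁-body φ₂-body) (φ₁∈L , φ₂∈L) x₀⊭φ with ¬×⇒¬⊎¬ lem x₀⊭φ
    ... | inj₁ x₀⊭φ₁ = forced-map (λ φ₁∉x₀ φ∈x₀ → φ₁∉x₀ (∈ₚ-up x₀ φ∈x₀ (x∧y≤x _ _)))
                         (body-fails φ₁ φ₁-body φ₁∈L x₀⊭φ₁)
    ... | inj₂ x₀⊭φ₂ = forced-map (λ φ₂∉x₀ φ∈x₀ → φ₂∉x₀ (∈ₚ-up x₀ φ∈x₀ (x∧y≤y _ _)))
                         (body-fails φ₂ φ₂-body φ₂∈L x₀⊭φ₂)
    body-fails (φ₁ ∨ᶠ φ₂) (body-∨ φ₁-body φ₂-body) (_ , φ₁∈L , φ₂∈L) x₀⊭φ =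
      forced-map (λ (φ₁∉x₀ , φ₂∉x₀) → ∨-prime x₀ φ₁∉x₀ φ₂∉x₀ ≤-refl)
        (forced-× (body-fails φ₁ φ₁-body φ₁∈L (x₀⊭φ ∘ inj₁)) (body-fails φ₂ φ₂-body φ₂∈L (x₀⊭φ ∘ inj₂)))
    body-fails φ (body-imp (imp-pos φ⁺)) φ∈L x₀⊭φ =
      positive-fails-forced φ φ⁺ φ∈L (λ R-valid i → inj₂ (inj₂ (All.map proj₁ (R-valid i)))) x₀⊭φ
    body-fails (¬ᶠ α) (body-imp (imp-¬ α-ant)) (_ , α∈L) x₀⊭¬α =
      let w , x₀⊑w , w⊨α , _ = em⇒dne lem x₀⊭¬α in
      forced-map (λ α∈w ¬α∈x₀ → ≤⊥⇒∉ₚ w ⇨-eval (∈ₚ-⊓ w (x₀⊑w _ ¬α∈x₀) α∈w))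
        (antecedent-holds α α-ant α∈L x₀⊑w w⊨α)
    body-fails (α ⇒ᶠ β) (body-imp (imp-⇒ α-ant β⁺)) (⇒∈L , α∈L , β∈L) x₀⊭α⇒β =
      let w , x₀⊑w , w⊨α , w⊭β = em⇒dne lem x₀⊭α⇒β in
      forced-map (λ (α∈w , β∉w) α⇒β∈x₀ → β∉w (∈ₚ-up w (∈ₚ-⊓ w (x₀⊑w _ α⇒β∈x₀) α∈w) ⇨-eval))
        (forced-× (antecedent-holds α α-ant α∈L x₀⊑w w⊨α)
                  (positive-fails-forced β β⁺ β∈L (λ _ _ → inj₁ ⇒∈L) w⊭β))

    premises-fail : ∀ φs → All SahlBody φs → (φs∈L : All (InLang L) φs) → All (λ φ → ¬ ⟦ φ ⟧ᵘ V x₀) φs →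
                    Forced (λ g → All (_∉ₚ x₀) (evalAll φs φs∈L g))
    premises-fail []       []                  []            []              =
      forced-everywhere λ R-valid → eventually-always R-valid []
    premises-fail (φ ∷ φs) (φ-body ∷ φs-body) (φ∈L ∷ φs∈L) (x₀⊭φ ∷ x₀⊭φs) =
      forced-map (λ (φ∉x₀ , φs∉x₀) → φ∉x₀ ∷ φs∉x₀)
        (forced-× (body-fails φ φ-body φ∈L x₀⊭φ) (premises-fail φs φs-body φs∈L x₀⊭φs))

  module _ (Φ : SahlQE) (Φ∈L : QEInLang L Φ) (A⊨Φ : ValidSub H sub Φ) where

    open SahlQE Φ

    module _ (g : Assignment) (f c : A) where

      private
        g′ : Assignment
        g′ = g [ z ↦ c ] [ y ↦ f ]

      g′-y : ⌊ g′ y ⌋ ≡ ⌊ f ⌋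
      g′-y = cong ⌊_⌋ ([↦]-≡ _ y f)

      g′-z : ⌊ g′ z ⌋ ≡ ⌊ c ⌋
      g′-z = cong ⌊_⌋ (trans ([↦]-≢ _ f (y≢z ∘ sym)) ([↦]-≡ g z c))

      premises-hold : ∀ φs (φs∈L : All (InLang L) φs) →
        All (λ φ → ¬ Occurs y φ) φs → All (λ φ → ¬ Occurs z φ) φs →
        All (λ b → ⌊ b ⌋ ∧ ⌊ f ⌋ ≤ ⌊ c ⌋) (evalAll φs φs∈L g) →
        All (λ φ → let v = evalH H (φ ∧ᶠ var y) (⌊_⌋ ∘ g′) in (v ∧ ⌊ g′ z ⌋) ≈ v) φs
      premises-hold [] [] [] [] [] = []
      premises-hold (φ ∷ φs) (_ ∷ φs∈L) (y∉φ ∷ y∉φs) (z∉φ ∷ z∉φs) (φ∧f≤c ∷ φs∧f≤c) =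
        subst₂ _≲_ (cong₂ _∧_ (sym φ-unchanged) (sym g′-y)) (sym g′-z) (≤⇒≲ φ∧f≤c) ∷
        premises-hold φs φs∈L y∉φs z∉φs φs∧f≤c
        where
          φ-unchanged : evalH H φ (⌊_⌋ ∘ g′) ≡ evalH H φ (⌊_⌋ ∘ g)
          φ-unchanged = evalH-occurs φ λ i i∈φ →
            cong ⌊_⌋ (trans ([↦]-≢ _ f λ i≡y → y∉φ (subst (λ j → Occurs j φ) i≡y i∈φ))
                            ([↦]-≢ g c λ i≡z → z∉φ (subst (λ j → Occurs j φ) i≡z i∈φ)))

    premises-not-all-refuted : ∀ V x₀ → ¬ All (λ φ → ¬ ⟦ φ ⟧ᵘ V x₀) premises
    premises-not-all-refuted V x₀ x₀⊭φs =
      let g , φs∉x₀ = forced-witness (premises-fail premises sahlqvist Φ∈L x₀⊭φs)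
          c , c∉x₀ , f , f∈x₀ , bounds =
            bound-outside x₀ (λ b a → a ≡ b) _ (All.map (λ b∉x₀ → _ , refl , b∉x₀) φs∉x₀)
          g′y≲g′z = A⊨Φ (g [ z ↦ c ] [ y ↦ f ])
                      (premises-hold g f c premises Φ∈L y-fresh z-fresh
                        (All.map (λ { (_ , refl , b∧f≤c) → b∧f≤c }) bounds))
      in c∉x₀ (∈ₚ-up x₀ f∈x₀ (subst₂ _≤_ (g′-y g f c) (g′-z g f c) (≲⇒≤ g′y≲g′z)))
      where open Countermodel x₀ V using (premises-fail; forced-witness)

theorem5p1 : (lem : ∀ {ℓ} → ExcludedMiddle ℓ) → (zorn : ∀ {a r k} → Zorn a r k) →
    ∀ {c ℓ₁ ℓ₂ p} (L : Lang) (Φ : SahlQE) → QEInLang L Φ →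
    (H : HeytingAlgebra c ℓ₁ ℓ₂) (P : Pred (HeytingAlgebra.Carrier H) p) →
    (sub : IsSubreduct H L P) →
    ValidSub H sub Φ → ValidUp H sub Φ
theorem5p1 lem zorn L Φ Φ∈L H P sub A⊨Φ V Φ-holds x = proj₁ , λ x∈Vy →
  x∈Vy , em⇒dne lem λ x∉Vz → premises-not-all-refuted Φ Φ∈L A⊨Φ V x
    (All.map (λ φ∧y≤z x⊨φ → x∉Vz (proj₂ (proj₂ (φ∧y≤z x) (x⊨φ , x∈Vy)))) Φ-holds)
  where open Transfer lem zorn H sub
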